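{- Let $U$ be a finite set, $\mathcal I$ an independence system on $U$, and $f:2^U\to\mathbb R$ a non-negative, monotone, submodular function. Let $\beta=\max_{S\in\mathcal I}|S|$, let $G$ be the set returned by the greedy algorithm, and let $O\in\mathcal I$ be an optimal solution, i.e. $f(O)=\max_{S\in\mathcal I}f(S)$. Then $f(G)\ge f(O)/\beta$.
   Context: An independence system on $U$ is a nonempty collection of subsets of $U$ closed under taking subsets. $f$ is submodular if $f(T\cup\{x\})-f(T)\le f(S\cup\{x\})-f(S)$ for all $S\subseteq T\subseteq U$, $x\in U\setminus T$; monotone if $S\subseteq T$ implies $f(S)\le f(T)$. The greedy algorithm: start with $G=\emptyset$; while $G$ is not maximal in $\mathcal I$, choose $g\in\arg\max_{s\in U:\,G\cup\{s\}\in\mathcal I} f(G\cup\{s\})$ (ties broken arbitrarily) and set $G\gets G\cup\{g\}$; return $G$. -}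

module Defs where

open import Level using (Level; _⊔_; suc)
import Data.Nat
open import Data.Nat using (ℕ; zero) renaming (suc to sucℕ)
open import Data.Product using (Σ; ∃; _×_; _,_)
import Data.Fin.Subset
open import Data.Fin using (Fin)
open import Data.Fin.Subset using (Subset; _⊆_; _∪_; ⁅_⁆; _∈_; _∉_; ∣_∣)
open import Relation.Binary.Structures using (IsTotalOrder)
open import Relation.Binary.PropositionalEquality using (_≡_)
open import Relation.Nullary using (¬_)
open import Algebra.Bundles using (CommutativeRing)

-- An ordered commutative ring (ℝ is an instance).  Values of the set function
-- live here; this covers f : 2^U → ℝ as a special case.
record OrderedCommutativeRing (c ℓ₁ ℓ₂ : Level) : Set (suc (c ⊔ ℓ₁ ⊔ ℓ₂)) where
  field
    commRing : CommutativeRing c ℓ₁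
  open CommutativeRing commRing public
  field
    _≤_          : Carrier → Carrier → Set ℓ₂
    isTotalOrder : IsTotalOrder _≈_ _≤_
    +-mono-≤     : ∀ {x y} z → x ≤ y → (x + z) ≤ (y + z)
    *-nonneg     : ∀ {x y} → 0# ≤ x → 0# ≤ y → 0# ≤ (x * y)

  fromℕ : ℕ → Carrier
  fromℕ zero     = 0#
  fromℕ (sucℕ n) = 1# + fromℕ n

module _ {c ℓ₁ ℓ₂ : Level} (R : OrderedCommutativeRing c ℓ₁ ℓ₂) where
  open OrderedCommutativeRing R

  -- U = Fin n; subsets of U are Subset n.

  IsIndependenceSystem : {n : ℕ} → (Subset n → Set) → Set
  IsIndependenceSystem {n} I =
    (∃ λ (S : Subset n) → I S) × (∀ {S T : Subset n} → S ⊆ T → I T → I S)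

  NonNegative : {n : ℕ} → (Subset n → Carrier) → Set ℓ₂
  NonNegative {n} f = ∀ (S : Subset n) → 0# ≤ f S

  Monotone : {n : ℕ} → (Subset n → Carrier) → Set ℓ₂
  Monotone {n} f = ∀ {S T : Subset n} → S ⊆ T → f S ≤ f T

  Submodular : {n : ℕ} → (Subset n → Carrier) → Set ℓ₂
  Submodular {n} f = ∀ {S T : Subset n} (x : Fin n) → S ⊆ T → x ∉ T →
    (f (T ∪ ⁅ x ⁆) - f T) ≤ (f (S ∪ ⁅ x ⁆) - f S)

  Maximal : {n : ℕ} → (Subset n → Set) → Subset n → Set
  Maximal {n} I G = ∀ (s : Fin n) → s ∉ G → ¬ I (G ∪ ⁅ s ⁆)

  GreedyStep : {n : ℕ} → (Subset n → Set) → (Subset n → Carrier) →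
               Subset n → Subset n → Set ℓ₂
  GreedyStep {n} I f G G' = Σ (Fin n) λ g →
    g ∉ G × I (G ∪ ⁅ g ⁆) ×
    (∀ (s : Fin n) → s ∉ G → I (G ∪ ⁅ s ⁆) → f (G ∪ ⁅ s ⁆) ≤ f (G ∪ ⁅ g ⁆)) ×
    G' ≡ G ∪ ⁅ g ⁆

  data GreedyReachable {n : ℕ} (I : Subset n → Set) (f : Subset n → Carrier) :
       Subset n → Set ℓ₂ where
    start : GreedyReachable I f Data.Fin.Subset.⊥
    step  : ∀ {G G'} → GreedyReachable I f G → GreedyStep I f G G' →
            GreedyReachable I f G'

  -- G is a possible output of the greedy algorithm (for some tie-breaking)
  GreedyOutput : {n : ℕ} → (Subset n → Set) → (Subset n → Carrier) →
                 Subset n → Set ℓ₂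
  GreedyOutput I f G = GreedyReachable I f G × Maximal I G

  IsMaxCard : {n : ℕ} → (Subset n → Set) → ℕ → Set
  IsMaxCard {n} I β = (∃ λ (S : Subset n) → I S × ∣ S ∣ ≡ β) ×
                      (∀ (S : Subset n) → I S → ∣ S ∣ Data.Nat.≤ β)

  IsOptimal : {n : ℕ} → (Subset n → Set) → (Subset n → Carrier) → Subset n → Set ℓ₂
  IsOptimal {n} I f O = I O × (∀ (S : Subset n) → I S → f S ≤ f O)

module Submission where

-- Every o ∈ O is a feasible first pick, so f {o} ≤ f G: the first greedy pick maximises
-- f over singletons and later picks only increase f.  By submodularity each element of
-- O then adds at most f G - f ∅ to any subset of O, so
--   f O ≤ f ∅ + |O| (f G - f ∅) ≤ f ∅ + β (f G - f ∅) ≤ β f G,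
-- the last step using f ∅ ≥ 0 and β ≥ 1.

open import Defs
open import Level using (Level)
open import Data.Nat using (ℕ; _≥_)
open import Data.Fin.Subset using (Subset)

import Data.Nat as ℕ
open import Data.Fin using (Fin; _≟_)
open import Data.Fin.Subset using (_⊆_; _⊂_; _∪_; ⁅_⁆; _∈_; _∉_; ∣_∣; _─_; ⊥; inside)
open import Data.Fin.Subset.Properties
  using (⊥⊆; ∉⊥; Empty-unique; nonempty?; x∈p∪q⁺; x∈⁅x⁆; x∈⁅y⁆⇒x≡y;
         x∈p∧x≢y⇒x∈p-y; p─q⊆p; x∈p⇒p-x⊂p; x∈p⇒∣p-x∣<∣p∣; p⊆p∪q; ∪-identityˡ)
open import Data.Fin.Subset.Induction using (⊂-wellFounded; Acc; acc)
open import Data.Vec using (_∷_; here; there)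
open import Data.Product using (_,_)
open import Data.Sum using (_⊎_; inj₁; inj₂)
open import Function using (_∘_)
open import Relation.Nullary using (yes; no; contradiction)
open import Relation.Binary.PropositionalEquality as ≡ using (_≡_)
open import Relation.Binary.Bundles using (Poset)
open import Relation.Binary.Structures using (IsTotalOrder)
import Relation.Binary.Reasoning.PartialOrder as PartialOrderReasoning
import Relation.Binary.Reasoning.Setoid as SetoidReasoning
import Algebra.Properties.Ring as RingProperties
import Algebra.Properties.Group as GroupProperties

x∈q⇒x∉p─q : ∀ {n} {x : Fin n} {p q : Subset n} → x ∈ q → x ∉ p ─ q
x∈q⇒x∉p─q {p = _ ∷ _} {inside ∷ _} here        ()
x∈q⇒x∉p─q {p = _ ∷ _} {_ ∷ _}      (there x∈q) (there x∈p─q) = x∈q⇒x∉p─q x∈q x∈p─q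

p⊆p─⁅x⁆∪⁅x⁆ : ∀ {n} (p : Subset n) (x : Fin n) → p ⊆ (p ─ ⁅ x ⁆) ∪ ⁅ x ⁆
p⊆p─⁅x⁆∪⁅x⁆ p x {y} y∈p with y ≟ x
... | yes ≡.refl = x∈p∪q⁺ (inj₂ (x∈⁅x⁆ y))
... | no y≢x   = x∈p∪q⁺ (inj₁ (x∈p∧x≢y⇒x∈p-y y∈p y≢x))

x∈p⇒⊥∪⁅x⁆⊆p : ∀ {n} {x : Fin n} {p : Subset n} → x ∈ p → ⊥ ∪ ⁅ x ⁆ ⊆ p
x∈p⇒⊥∪⁅x⁆⊆p {x = x} x∈p {y} y∈⊥∪⁅x⁆ =
  ≡.subst (_∈ _) (≡.sym (x∈⁅y⁆⇒x≡y x (≡.subst (y ∈_) (∪-identityˡ ⁅ x ⁆) y∈⊥∪⁅x⁆))) x∈p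

module OrderedCommutativeRingProperties {c ℓ₁ ℓ₂ : Level} (R : OrderedCommutativeRing c ℓ₁ ℓ₂) where
  open OrderedCommutativeRing R renaming (_≤_ to infix 4 _≤_)
  open IsTotalOrder isTotalOrder using (total; ≤-respˡ-≈; ≤-respʳ-≈)
    renaming (refl to ≤-refl; trans to ≤-trans)
  open RingProperties ring using (-1*x≈-x; -‿involutive)
  open GroupProperties +-group using (//-rightDividesˡ)

  poset : Poset c ℓ₁ ℓ₂
  poset = record { isPartialOrder = IsTotalOrder.isPartialOrder isTotalOrder }

  module ≤-Reasoning = PartialOrderReasoning poset
  module ≈-Reasoning = SetoidReasoning setoid

  x-y+y≈x : ∀ x y → (x - y) + y ≈ x
  x-y+y≈x x y = //-rightDividesˡ y x

  +-monoʳ-≤ : ∀ {x y} z → x ≤ y → z + x ≤ z + y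
  +-monoʳ-≤ z x≤y = ≤-respʳ-≈ (+-comm _ z) (≤-respˡ-≈ (+-comm _ z) (+-mono-≤ z x≤y))

  x≤y⇒0≤y-x : ∀ {x y} → x ≤ y → 0# ≤ y - x
  x≤y⇒0≤y-x {x} x≤y = ≤-respˡ-≈ (-‿inverseʳ x) (+-mono-≤ (- x) x≤y)

  -- In the case 1 ≤ 0 we get 0 ≤ -1, and then 0 ≤ (-1)(-1) = 1.
  0≤1 : 0# ≤ 1#
  0≤1 with total 0# 1#
  ... | inj₁ 0≤1 = 0≤1
  ... | inj₂ 1≤0 = ≤-respʳ-≈ -1*-1≈1 (*-nonneg 0≤-1 0≤-1)
    where
    0≤-1 : 0# ≤ - 1#
    0≤-1 = ≤-respˡ-≈ (-‿inverseʳ 1#) (≤-respʳ-≈ (+-identityˡ (- 1#)) (+-mono-≤ (- 1#) 1≤0))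
    -1*-1≈1 : - 1# * - 1# ≈ 1#
    -1*-1≈1 = trans (-1*x≈-x (- 1#)) (-‿involutive 1#)

  0≤fromℕ : ∀ n → 0# ≤ fromℕ n
  0≤fromℕ ℕ.zero    = ≤-refl
  0≤fromℕ (ℕ.suc n) = ≤-respˡ-≈ (+-identityʳ 0#) (≤-trans (+-mono-≤ 0# 0≤1) (+-monoʳ-≤ 1# (0≤fromℕ n)))

  fromℕ-mono-≤ : ∀ {m n} → m ℕ.≤ n → fromℕ m ≤ fromℕ n
  fromℕ-mono-≤ {n = n} ℕ.z≤n = 0≤fromℕ n
  fromℕ-mono-≤ (ℕ.s≤s m≤n)   = +-monoʳ-≤ 1# (fromℕ-mono-≤ m≤n)

  *-monoˡ-≤-nonNeg : ∀ {x y} z → 0# ≤ z → x ≤ y → x * z ≤ y * z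
  *-monoˡ-≤-nonNeg {x} {y} z 0≤z x≤y = begin
    x * z                   ≈⟨ +-identityʳ (x * z) ⟨
    x * z + 0#              ≤⟨ +-monoʳ-≤ (x * z) (*-nonneg (x≤y⇒0≤y-x x≤y) 0≤z) ⟩
    x * z + (y - x) * z     ≈⟨ +-comm (x * z) _ ⟩
    (y - x) * z + x * z     ≈⟨ distribʳ z (y - x) x ⟨
    ((y - x) + x) * z       ≈⟨ *-congʳ (x-y+y≈x y x) ⟩
    y * z                   ∎
    where open ≤-Reasoning

  *-monoʳ-≤-nonNeg : ∀ {x y} z → 0# ≤ z → x ≤ y → z * x ≤ z * y
  *-monoʳ-≤-nonNeg z 0≤z x≤y =
    ≤-respˡ-≈ (*-comm _ z) (≤-respʳ-≈ (*-comm _ z) (*-monoˡ-≤-nonNeg z 0≤z x≤y))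

  [1+k]*x≈x+k*x : ∀ k x → (1# + k) * x ≈ x + k * x
  [1+k]*x≈x+k*x k x = trans (distribʳ x 1# k) (+-congʳ (*-identityˡ x))

  x≤x+y : ∀ x {y} → 0# ≤ y → x ≤ x + y
  x≤x+y x 0≤y = ≤-respˡ-≈ (+-identityʳ x) (+-monoʳ-≤ x 0≤y)

  [x+k*d]+d≈x+[1+k]*d : ∀ x k d → (x + k * d) + d ≈ x + (1# + k) * d
  [x+k*d]+d≈x+[1+k]*d x k d = begin
    (x + k * d) + d    ≈⟨ +-assoc x (k * d) d ⟩
    x + (k * d + d)    ≈⟨ +-congˡ (+-comm (k * d) d) ⟩
    x + (d + k * d)    ≈⟨ +-congˡ ([1+k]*x≈x+k*x k d) ⟨
    x + (1# + k) * d   ∎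
    where open ≈-Reasoning

  0≤x⇒y-x≤y : ∀ {x} y → 0# ≤ x → y - x ≤ y
  0≤x⇒y-x≤y {x} y 0≤x = ≤-respʳ-≈ (+-identityʳ y) (+-monoʳ-≤ y -x≤0)
    where
    -x≤0 : - x ≤ 0#
    -x≤0 = ≤-respˡ-≈ (+-identityˡ (- x)) (≤-respʳ-≈ (-‿inverseʳ x) (+-mono-≤ (- x) 0≤x))

  c+[1+k][m-c]≤[1+k]m : ∀ {c m k} → 0# ≤ k → 0# ≤ c → c + (1# + k) * (m - c) ≤ (1# + k) * m
  c+[1+k][m-c]≤[1+k]m {c} {m} {k} 0≤k 0≤c = begin
    c + (1# + k) * (m - c)        ≈⟨ +-congˡ ([1+k]*x≈x+k*x k (m - c)) ⟩
    c + ((m - c) + k * (m - c))   ≈⟨ +-assoc c (m - c) _ ⟨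
    (c + (m - c)) + k * (m - c)   ≈⟨ +-congʳ (trans (+-comm c (m - c)) (x-y+y≈x m c)) ⟩
    m + k * (m - c)               ≤⟨ +-monoʳ-≤ m (*-monoʳ-≤-nonNeg k 0≤k (0≤x⇒y-x≤y m 0≤c)) ⟩
    m + k * m                     ≈⟨ [1+k]*x≈x+k*x k m ⟨
    (1# + k) * m                  ∎
    where open ≤-Reasoning

module SetFunctionProperties {c ℓ₁ ℓ₂ : Level} (R : OrderedCommutativeRing c ℓ₁ ℓ₂)
                            {n : ℕ} (f : Subset n → OrderedCommutativeRing.Carrier R) where
  open OrderedCommutativeRing R renaming (_≤_ to infix 4 _≤_)
  open OrderedCommutativeRingProperties R
  open IsTotalOrder isTotalOrder using () renaming (trans to ≤-trans)

  -- Peel off one element x at a time: by submodularity (compared with ⊥) adding x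
  -- gains at most f {x} - f ⊥.
  f≤f⊥+∣p∣*d : Monotone R f → Submodular R f → ∀ {d} → 0# ≤ d → ∀ p →
               (∀ {x} → x ∈ p → f (⊥ ∪ ⁅ x ⁆) - f ⊥ ≤ d) → f p ≤ f ⊥ + fromℕ ∣ p ∣ * d
  f≤f⊥+∣p∣*d mono sub {d} 0≤d p = go p (⊂-wellFounded p)
    where
    go : ∀ p → Acc _⊂_ p → (∀ {x} → x ∈ p → f (⊥ ∪ ⁅ x ⁆) - f ⊥ ≤ d) →
         f p ≤ f ⊥ + fromℕ ∣ p ∣ * d
    go p (acc rec) gain≤d with nonempty? p
    ... | no p-empty with ≡.refl ← Empty-unique p-empty =
      x≤x+y (f ⊥) (*-nonneg (0≤fromℕ ∣ ⊥ {n = n} ∣) 0≤d)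
    ... | yes (x , x∈p) = begin
      f p                                 ≤⟨ mono (p⊆p─⁅x⁆∪⁅x⁆ p x) ⟩
      f (q ∪ ⁅ x ⁆)                       ≈⟨ x-y+y≈x (f (q ∪ ⁅ x ⁆)) (f q) ⟨
      (f (q ∪ ⁅ x ⁆) - f q) + f q         ≤⟨ +-mono-≤ (f q) gain[q,x]≤d ⟩
      d + f q                             ≤⟨ +-monoʳ-≤ d (go q (rec q⊂p) (gain≤d ∘ p─q⊆p p ⁅ x ⁆)) ⟩
      d + (f ⊥ + fromℕ ∣ q ∣ * d)         ≈⟨ +-comm d _ ⟩
      (f ⊥ + fromℕ ∣ q ∣ * d) + d         ≈⟨ [x+k*d]+d≈x+[1+k]*d (f ⊥) (fromℕ ∣ q ∣) d ⟩
      f ⊥ + fromℕ (ℕ.suc ∣ q ∣) * d       ≤⟨ +-monoʳ-≤ (f ⊥) (*-monoˡ-≤-nonNeg d 0≤d ∣q∣<∣p∣) ⟩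
      f ⊥ + fromℕ ∣ p ∣ * d               ∎
      where
      open ≤-Reasoning
      q : Subset n
      q = p ─ ⁅ x ⁆
      q⊂p : q ⊂ p
      q⊂p = x∈p⇒p-x⊂p x∈p
      ∣q∣<∣p∣ : fromℕ (ℕ.suc ∣ q ∣) ≤ fromℕ ∣ p ∣
      ∣q∣<∣p∣ = fromℕ-mono-≤ (x∈p⇒∣p-x∣<∣p∣ x∈p)
      gain[q,x]≤d : f (q ∪ ⁅ x ⁆) - f q ≤ d
      gain[q,x]≤d = ≤-trans (sub x ⊥⊆ (x∈q⇒x∉p─q (x∈⁅x⁆ x))) (gain≤d x∈p)

module GreedyProperties {c ℓ₁ ℓ₂ : Level} (R : OrderedCommutativeRing c ℓ₁ ℓ₂)
                        {n : ℕ} {I : Subset n → Set} {f : Subset n → OrderedCommutativeRing.Carrier R}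
                        (mono : Monotone R f) where
  open OrderedCommutativeRing R renaming (_≤_ to infix 4 _≤_)
  open IsTotalOrder isTotalOrder using () renaming (trans to ≤-trans)

  greedyReachable⇒⊥∨singleton≤ : ∀ {G} → GreedyReachable R I f G →
    G ≡ ⊥ ⊎ (∀ s → I (⊥ ∪ ⁅ s ⁆) → f (⊥ ∪ ⁅ s ⁆) ≤ f G)
  greedyReachable⇒⊥∨singleton≤ start = inj₁ ≡.refl
  greedyReachable⇒⊥∨singleton≤ (step reachable (g , _ , _ , best , ≡.refl))
    with greedyReachable⇒⊥∨singleton≤ reachable
  ... | inj₁ ≡.refl      = inj₂ (λ s I⁅s⁆ → best s ∉⊥ I⁅s⁆)
  ... | inj₂ singleton≤G = inj₂ (λ s I⁅s⁆ → ≤-trans (singleton≤G s I⁅s⁆) (mono (p⊆p∪q ⁅ g ⁆)))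

  greedyOutput⇒singleton≤ : ∀ {G} → GreedyOutput R I f G →
    ∀ s → I (⊥ ∪ ⁅ s ⁆) → f (⊥ ∪ ⁅ s ⁆) ≤ f G
  greedyOutput⇒singleton≤ (reachable , maximal) s I⁅s⁆ with greedyReachable⇒⊥∨singleton≤ reachable
  ... | inj₁ ≡.refl      = contradiction I⁅s⁆ (maximal s ∉⊥)
  ... | inj₂ singleton≤G = singleton≤G s I⁅s⁆

mainTheorem4 : {c ℓ₁ ℓ₂ : Level} (R : OrderedCommutativeRing c ℓ₁ ℓ₂) →
    let open OrderedCommutativeRing R in
    (n : ℕ) (I : Subset n → Set) (f : Subset n → Carrier) →
    IsIndependenceSystem R I → NonNegative R f → Monotone R f → Submodular R f →
    (β : ℕ) → IsMaxCard R I β → β ≥ 1 →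
    (G : Subset n) → GreedyOutput R I f G →
    (O : Subset n) → IsOptimal R I f O →
    f O ≤ (fromℕ β * f G)
mainTheorem4 R n I f (_ , downClosed) f≥0 mono sub (ℕ.suc k) (_ , ∣S∣≤β) (ℕ.s≤s ℕ.z≤n) G greedy O (I[O] , _) =
  begin
    f O                                   ≤⟨ f≤f⊥+∣p∣*d mono sub 0≤f[G]-f[⊥] O gain≤f[G]-f[⊥] ⟩
    f ⊥ + fromℕ ∣ O ∣ * (f G - f ⊥)       ≤⟨ +-monoʳ-≤ (f ⊥) (*-monoˡ-≤-nonNeg _ 0≤f[G]-f[⊥] ∣O∣≤β) ⟩
    f ⊥ + fromℕ (ℕ.suc k) * (f G - f ⊥)   ≤⟨ c+[1+k][m-c]≤[1+k]m (0≤fromℕ k) (f≥0 ⊥) ⟩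
    fromℕ (ℕ.suc k) * f G                 ∎
  where
  open OrderedCommutativeRing R renaming (_≤_ to infix 4 _≤_)
  open OrderedCommutativeRingProperties R
  open ≤-Reasoning
  open SetFunctionProperties R f
  open GreedyProperties R mono

  0≤f[G]-f[⊥] : 0# ≤ f G - f ⊥
  0≤f[G]-f[⊥] = x≤y⇒0≤y-x (mono ⊥⊆)

  ∣O∣≤β : fromℕ ∣ O ∣ ≤ fromℕ (ℕ.suc k)
  ∣O∣≤β = fromℕ-mono-≤ (∣S∣≤β O I[O])

  gain≤f[G]-f[⊥] : ∀ {o} → o ∈ O → f (⊥ ∪ ⁅ o ⁆) - f ⊥ ≤ f G - f ⊥
  gain≤f[G]-f[⊥] o∈O =
    +-mono-≤ (- f ⊥) (greedyOutput⇒singleton≤ greedy _ (downClosed (x∈p⇒⊥∪⁅x⁆⊆p o∈O) I[O]))
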